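{- Let $p$ be a prime. (1) Let $\mathcal{E}$ be any collection of coefficient functions (containing the zero function and all $\beta^i$) such that $\epsilon_n<p$ for all $n\ge1$ and all $\epsilon\in\mathcal{E}$. If $Q$ is a decreasing sequence in $\mathbb{Z}_p$, then $Q$ has the unique $\mathcal{E}$-representation property. (2) Let $\mathcal{E}_0$ be a Zeckendorf collection for positive integers and $\mathcal{E}$ its completion. If $\epsilon_n\le\min\{\sqrt p,(p-1)/2\}$ for all $n\ge1$ and all $\epsilon\in\mathcal{E}$, then every decreasing $\mathcal{E}$-subset of $\mathbb{Z}_p$ has a unique decreasing fundamental sequence.
   Context: A coefficient function is a map $\epsilon:\{1,2,\dots\}\to\{0,1,2,\dots\}$; $\beta^i$ has $\beta^i_i=1$ and $0$ elsewhere; $\sum\epsilon Q=\sum_{k\ge1}\epsilon_kQ_k$. A sequence $Q$ in $\mathbb{Z}_p$ is decreasing if $|Q_k|_p>|Q_{k+1}|_p$ for all $k$ (so all such sums converge $p$-adically). $Q$ has the unique $\mathcal{E}$-representation property if the values $\sum\delta Q$, $\delta\in\mathcal{E}$, are pairwise distinct; $X_Q=\{\sum\delta Q:\delta\in\mathcal{E},\delta\ne0\}$. A decreasing $\mathcal{E}$-subset of $\mathbb{Z}_p$ is a set $Y=X_Q$ for some decreasing $Q$ with the unique $\mathcal{E}$-representation property; such $Q$ is a decreasing fundamental sequence for $Y$. Zeckendorf for positive integers: for finite-support functions, $\mu<_a\mu'$ means at the largest index $k$ where they differ $\mu_k<\mu'_k$; $\mathcal{E}_0$ is a set of finite-support coefficient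 functions containing $0$ and all $\beta^i$, ordered by $<_a$, with $\hat\beta^n$ the largest element below $\beta^n$, such that (1) each $\mu\in\mathcal{E}_0$ has finitely many elements of $\mathcal{E}_0$ below it, and (2) for each $\mu\in\mathcal{E}_0$, if its immediate successor (smallest greater element) $\tilde\mu$ is not $\beta^1+\mu$, then there is $n\ge2$ with $\mu_k=\hat\beta^n_k$ for $1\le k<n$ and $\tilde\mu=\beta^n+\sum_{k\ge n}\mu_k\beta^k$. For nonzero finite-support $\mu$, $\mathrm{ord}(\mu)$ = largest $n$ with $\mu_n\ne0$, $\mathrm{ord}(0)=0$. A coefficient function $\mu$ is the limit of a sequence $\mu^k$ in $\mathcal{E}_0$ if there is an increasing sequence of indices $M_k\ge\mathrm{ord}(\mu^k)$ with $\mu_j=\mu^k_j$ for all $1\le j\le M_k$ and all $k$; the completion $\mathcal{E}$ of $\mathcal{E}_0$ is the set of all such limits. -}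

module Defs where

open import Data.Nat as ℕ using (ℕ; zero; suc; _≤_; _<_; _^_; _≤ᵇ_; _≟_)
open import Data.Nat.Divisibility using (_∣_)
open import Data.Integer as ℤ using (ℤ; ∣_∣)
open import Data.Bool using (if_then_else_)
open import Data.List using (List)
open import Data.List.Relation.Unary.Any using (Any)
open import Data.Product using (Σ; ∃; _×_; _,_)
open import Data.Sum using (_⊎_)
open import Data.Empty using (⊥)
open import Relation.Nullary using (¬_; yes; no)
open import Relation.Binary.PropositionalEquality using (_≡_)

-- Index convention: coefficient functions and sequences are indexed
-- from 0 in Agda; Agda index k stands for the paper's index k+1.

Coef : Set
Coef = ℕ → ℕ

_≗c_ : Coef → Coef → Set
μ ≗c ν = ∀ j → μ j ≡ ν j

zeroC : Coef
zeroC _ = 0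

β : ℕ → Coef
β i j with i ≟ j
... | yes _ = 1
... | no  _ = 0

-- p-adic integers, as the inverse limit of ℤ/p^n:
-- a sequence of integers with x (n+1) ≡ x n (mod p^n);
-- x n is a representative of x modulo p^n.

_≡_[mod_] : ℤ → ℤ → ℕ → Set
a ≡ b [mod m ] = m ∣ ∣ a ℤ.- b ∣

record ℤₚ (p : ℕ) : Set where
  field
    seq : ℕ → ℤ
    coh : ∀ n → seq (suc n) ≡ seq n [mod p ^ n ]
open ℤₚ public

_≈ₚ_ : {p : ℕ} → ℤₚ p → ℤₚ p → Set
_≈ₚ_ {p} x y = ∀ n → seq x n ≡ seq y n [mod p ^ n ]

-- |x|_p > |y|_p  ⇔  v_p(x) < v_p(y)  ⇔  ∃ n. x ≢ 0 and y ≡ 0 (mod p^(n+1))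
_>ₚ_ : {p : ℕ} → ℤₚ p → ℤₚ p → Set
_>ₚ_ {p} x y = ∃ λ n → ¬ (seq x (suc n) ≡ ℤ.0ℤ [mod p ^ suc n ])
                     × (seq y (suc n) ≡ ℤ.0ℤ [mod p ^ suc n ])

Decreasing : {p : ℕ} → (ℕ → ℤₚ p) → Set
Decreasing Q = ∀ k → Q k >ₚ Q (suc k)

partialSum : {p : ℕ} → Coef → (ℕ → ℤₚ p) → ℕ → ℕ → ℤ
partialSum ε Q zero    m = ℤ.0ℤ
partialSum ε Q (suc N) m = partialSum ε Q N m ℤ.+ (ℤ.+ (ε N)) ℤ.* seq (Q N) m

SumTo : {p : ℕ} → Coef → (ℕ → ℤₚ p) → ℤₚ p → Set
SumTo {p} ε Q x = ∀ m → ∃ λ N → ∀ N' → N ≤ N' →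
  partialSum ε Q N' m ≡ seq x m [mod p ^ m ]

UniqueRep : {p : ℕ} → (Coef → Set) → (ℕ → ℤₚ p) → Set
UniqueRep {p} E Q = ∀ δ δ' → E δ → E δ' → ¬ (δ ≗c δ') →
  ∀ (x y : ℤₚ p) → SumTo δ Q x → SumTo δ' Q y → ¬ (x ≈ₚ y)

InX : {p : ℕ} → (Coef → Set) → (ℕ → ℤₚ p) → ℤₚ p → Set
InX E Q x = ∃ λ δ → E δ × ¬ (δ ≗c zeroC) × SumTo δ Q x

Fundamental : {p : ℕ} → (Coef → Set) → (ℤₚ p → Set) → (ℕ → ℤₚ p) → Set
Fundamental {p} E Y Q = Decreasing Q × UniqueRep E Q
  × (∀ (x : ℤₚ p) → (Y x → InX E Q x) × (InX E Q x → Y x))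

DecreasingESubset : {p : ℕ} → (Coef → Set) → (ℤₚ p → Set) → Set
DecreasingESubset {p} E Y = ∃ λ (Q : ℕ → ℤₚ p) → Fundamental E Y Q

FiniteSupport : Coef → Set
FiniteSupport μ = ∃ λ N → ∀ j → N ≤ j → μ j ≡ 0

_<ₐ_ : Coef → Coef → Set
μ <ₐ ν = ∃ λ k → μ k < ν k × (∀ j → k < j → μ j ≡ ν j)

IsLargestBelow : (Coef → Set) → Coef → Coef → Set
IsLargestBelow E0 b ν = E0 ν × ν <ₐ b
  × (∀ ν' → E0 ν' → ν' <ₐ b → (ν' <ₐ ν) ⊎ (ν' ≗c ν))

IsSuccessor : (Coef → Set) → Coef → Coef → Set
IsSuccessor E0 μ μ̃ = E0 μ̃ × μ <ₐ μ̃
  × (∀ ν → E0 ν → μ <ₐ ν → ν <ₐ μ̃ → ⊥)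

plusβ1 : Coef → Coef
plusβ1 μ j = β 0 j ℕ.+ μ j

stepUp : ℕ → Coef → Coef
stepUp n μ j = β n j ℕ.+ (if n ≤ᵇ j then μ j else 0)

record IsZeckendorf (E0 : Coef → Set) : Set₁ where
  field
    finiteSupport : ∀ μ → E0 μ → FiniteSupport μ
    hasZero       : E0 zeroC
    hasβ          : ∀ i → E0 (β i)
    hasHat        : ∀ n → ∃ λ ν → IsLargestBelow E0 (β n) ν
    finiteBelow   : ∀ μ → E0 μ → ∃ λ (L : List Coef) →
                      ∀ ν → E0 ν → ν <ₐ μ → Any (ν ≗c_) L
    successor     : ∀ μ μ̃ → E0 μ → IsSuccessor E0 μ μ̃ → ¬ (μ̃ ≗c plusβ1 μ) →
                      ∃ λ n → 1 ≤ n × (∃ λ ν → IsLargestBelow E0 (β n) ν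
                        × (∀ k → k < n → μ k ≡ ν k)
                        × (μ̃ ≗c stepUp n μ))

-- ord(μ) ≤ M (paper indexing), i.e. μ vanishes at Agda indices ≥ M
OrdLE : Coef → ℕ → Set
OrdLE μ M = ∀ j → M ≤ j → μ j ≡ 0

Completion : (Coef → Set) → Coef → Set
Completion E0 μ = ∃ λ (s : ℕ → Coef) → ∃ λ (M : ℕ → ℕ) →
    (∀ k → E0 (s k))
  × (∀ k → M k < M (suc k))
  × (∀ k → OrdLE (s k) (M k))
  × (∀ k j → j < M k → μ j ≡ s k j)

{-# OPTIONS --safe #-}
module Submission where

-- If Q is decreasing, the valuations v k of the Q k increase strictly, so modulo p ^ (v m + 1) a
-- sum Σ δ Q only sees its terms of index ≤ m, and there the term δ m · Q m vanishes only if
-- p ∣ δ m. This gives (1): where two coefficient functions first differ, the difference of their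
-- coefficients is divisible by p and smaller than p.
--
-- For (2), let A and B be fundamental sequences of the same set, so that every B n is an
-- E-combination of the A k and vice versa. The leading term of such a combination determines its
-- valuation, so A and B have the same valuations and B n ≡ c · A n, A n ≡ c′ · B n modulo
-- p ^ (v n + 1) for the leading coefficients c, c′. Hence p ∣ 1 − c′c, and 1 ≤ c′c ≤ p forces
-- c = c′ = 1. If B n ≠ A n, consider the first index m (resp. m′) at which the expansion of B n
-- in A (resp. of A n in B) differs from β n. If m < m′, then A n ≡ B n modulo p ^ v m′ contradicts
-- B n ≡ A n + e · A m modulo p ^ (v m + 1); if m = m′ the two expansions add up to
-- (e + e′) · A m ≡ 0, impossible since 0 < e + e′ < p. Each of these first indices is found by a
-- search bounded through the valuations, which keeps the argument constructive.

open import Defs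
open import Data.Nat
  using (ℕ; zero; suc; _+_; _*_; _∸_; _^_; _<_; _≤_; _≤′_; ≤′-refl; ≤′-step; z≤n; s≤s; z<s;
         _⊔_; _≤?_; _≟_; ∣_-_∣; NonZero; >-nonZero⁻¹)
open import Data.Nat.Properties
open import Data.Nat.Divisibility
  using (_∣_; divides; _∣?_; _∣0; 1∣_; ∣-refl; ∣-trans; ∣n⇒∣m*n; *-cancelʳ-∣; *-monoˡ-∣; >⇒∤)
open import Data.Nat.Induction using (<-rec)
open import Data.Nat.Primality using (Prime; prime⇒nonZero; euclidsLemma)
open import Data.Integer as ℤ using (ℤ; +_; 0ℤ; _⊖_)
import Data.Integer.Properties as ℤ
import Data.Integer.Divisibility.Signed as Signed
open import Data.Integer.Tactic.RingSolver using (solve-∀)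
open import Data.Empty using (⊥; ⊥-elim)
open import Data.Product using (Σ; ∃; _×_; _,_; proj₁; proj₂)
open import Data.Sum using (_⊎_; inj₁; inj₂)
open import Relation.Binary.Bundles using (Setoid)
open import Relation.Binary.Definitions using (tri<; tri≈; tri>)
open import Relation.Binary.PropositionalEquality
  using (_≡_; _≢_; refl; sym; trans; cong; cong₂; subst; subst₂; module ≡-Reasoning)
import Relation.Binary.Reasoning.Setoid as SetoidReasoning
open import Relation.Nullary using (¬_; Dec; yes; no)
open import Relation.Nullary.Decidable using (map′; decidable-stable)
open import Relation.Unary using (Decidable)

private variable
  m n o : ℕ
  a b c d : ℤ

m∣n∧n<m⇒n≡0 : .{{NonZero m}} → m ∣ n → n < m → n ≡ 0
m∣n∧n<m⇒n≡0 {n = zero}  _   _   = refl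
m∣n∧n<m⇒n≡0 {n = suc _} m∣n n<m = ⊥-elim (>⇒∤ n<m m∣n)

^-monoʳ-∣ : ∀ m → n ≤ o → m ^ n ∣ m ^ o
^-monoʳ-∣ m n≤o = go (≤⇒≤′ n≤o)
  where
  go : n ≤′ o → m ^ n ∣ m ^ o
  go ≤′-refl        = ∣-refl
  go (≤′-step n≤′o) = ∣n⇒∣m*n m (go n≤′o)

m*m≤o⇒n*n≤o⇒m*n≤o : ∀ m n → m * m ≤ o → n * n ≤ o → m * n ≤ o
m*m≤o⇒n*n≤o⇒m*n≤o m n m*m≤o n*n≤o with ≤-total m n
... | inj₁ m≤n = ≤-trans (*-monoˡ-≤ n m≤n) n*n≤o
... | inj₂ n≤m = ≤-trans (*-monoʳ-≤ m n≤m) m*m≤o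

2*m≤o⇒2*n≤o⇒m+n≤o : ∀ m n → 2 * m ≤ o → 2 * n ≤ o → m + n ≤ o
2*m≤o⇒2*n≤o⇒m+n≤o m n 2m≤o 2n≤o with ≤-total m n
... | inj₁ m≤n = ≤-trans (+-monoˡ-≤ n m≤n) (≤-trans (+-monoʳ-≤ n (m≤m+n n 0)) 2n≤o)
... | inj₂ n≤m = ≤-trans (+-monoʳ-≤ m n≤m) (≤-trans (+-monoʳ-≤ m (m≤m+n m 0)) 2m≤o)

∣[+m]-[+n]∣≡∣m-n∣ : ∀ m n → ℤ.∣ + m ℤ.- + n ∣ ≡ ∣ m - n ∣
∣[+m]-[+n]∣≡∣m-n∣ m n with ≤-total m n
... | inj₁ m≤n = begin
  ℤ.∣ + m ℤ.- + n ∣ ≡⟨ cong ℤ.∣_∣ (ℤ.[+m]-[+n]≡m⊖n m n) ⟩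
  ℤ.∣ m ⊖ n ∣       ≡⟨ ℤ.∣⊖∣-≤ m≤n ⟩
  n ∸ m             ≡⟨ m≤n⇒∣m-n∣≡n∸m m≤n ⟨
  ∣ m - n ∣         ∎
  where open ≡-Reasoning
... | inj₂ n≤m = begin
  ℤ.∣ + m ℤ.- + n ∣ ≡⟨ cong ℤ.∣_∣ (ℤ.[+m]-[+n]≡m⊖n m n) ⟩
  ℤ.∣ m ⊖ n ∣       ≡⟨ ℤ.∣m⊖n∣≡∣n⊖m∣ m n ⟩
  ℤ.∣ n ⊖ m ∣       ≡⟨ ℤ.∣⊖∣-≤ n≤m ⟩
  m ∸ n             ≡⟨ m≤n⇒∣n-m∣≡n∸m n≤m ⟨
  ∣ m - n ∣         ∎
  where open ≡-Reasoning

leastCounterexample : {P : ℕ → Set} → Decidable P → ∀ n →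
                      (∀ i → i < n → P i) ⊎ ∃ λ j → j < n × ¬ P j × (∀ i → i < j → P i)
leastCounterexample P? zero = inj₁ λ _ ()
leastCounterexample {P} P? (suc n) with leastCounterexample P? n
... | inj₂ (j , j<n , ¬Pj , below) = inj₂ (j , m≤n⇒m≤1+n j<n , ¬Pj , below)
... | inj₁ below with P? n
...   | no ¬Pn = inj₂ (n , ≤-refl , ¬Pn , below)
...   | yes Pn = inj₁ extend
  where
  extend : ∀ i → i < suc n → P i
  extend i i<1+n with m≤n⇒m<n∨m≡n (≤-pred i<1+n)
  ... | inj₁ i<n  = below i i<n
  ... | inj₂ refl = Pn

module StrictlyIncreasing (f : ℕ → ℕ) (f-inc : ∀ k → f k < f (suc k)) where

  mono-≤ : m ≤ n → f m ≤ f n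
  mono-≤ m≤n = go (≤⇒≤′ m≤n)
    where
    go : m ≤′ n → f m ≤ f n
    go ≤′-refl        = ≤-refl
    go (≤′-step m≤′n) = ≤-trans (go m≤′n) (<⇒≤ (f-inc _))

  mono-< : m < n → f m < f n
  mono-< {m} m<n = <-≤-trans (f-inc m) (mono-≤ m<n)

  cancel-< : f m < f n → m < n
  cancel-< {m} {n} fm<fn with n ≤? m
  ... | yes n≤m = ⊥-elim (<⇒≱ fm<fn (mono-≤ n≤m))
  ... | no  n≰m = ≰⇒> n≰m

  injective : f m ≡ f n → m ≡ n
  injective {m} {n} fm≡fn with <-cmp m n
  ... | tri< m<n _ _ = ⊥-elim (<⇒≢ (mono-< m<n) fm≡fn)
  ... | tri≈ _ m≡n _ = m≡n
  ... | tri> _ _ n<m = ⊥-elim (<⇒≢ (mono-< n<m) (sym fm≡fn))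

  n≤f[n] : ∀ n → n ≤ f n
  n≤f[n] zero    = z≤n
  n≤f[n] (suc n) = ≤-trans (s≤s (n≤f[n] n)) (f-inc n)

-- By induction on k: once g and f agree below k, the value g k can only occur in f at an index
-- ≥ k, so g k ≥ f k; symmetrically f k ≥ g k.
increasing-sameRange⇒≗ : (f g : ℕ → ℕ) → (∀ k → f k < f (suc k)) → (∀ k → g k < g (suc k)) →
                         (∀ k → ∃ λ j → g k ≡ f j) → (∀ k → ∃ λ i → f k ≡ g i) → ∀ k → g k ≡ f k
increasing-sameRange⇒≗ f g f-inc g-inc g⊆f f⊆g = agree
  where
  module F = StrictlyIncreasing f f-inc
  module G = StrictlyIncreasing g g-inc
  agree : ∀ k → g k ≡ f k
  index-in-f : ∀ k j → g k ≡ f j → k ≤ j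
  index-in-g : ∀ k i → f k ≡ g i → k ≤ i
  agree k with g⊆f k | f⊆g k
  ... | j , gk≡fj | i , fk≡gi = ≤-antisym
    (subst (g k ≤_) (sym fk≡gi) (G.mono-≤ (index-in-g k i fk≡gi)))
    (subst (f k ≤_) (sym gk≡fj) (F.mono-≤ (index-in-f k j gk≡fj)))
  index-in-f zero    j _     = z≤n
  index-in-f (suc k) j gk≡fj =
    F.cancel-< (subst (_< f j) (agree k) (subst (g k <_) gk≡fj (g-inc k)))
  index-in-g zero    i _     = z≤n
  index-in-g (suc k) i fk≡gi =
    G.cancel-< (subst (_< g i) (sym (agree k)) (subst (f k <_) fk≡gi (f-inc k)))

-- `_≡_[mod_]` wrapped in a record, so that its arguments can be inferred.
infix 4 _≋_[mod_]
record _≋_[mod_] (a b : ℤ) (m : ℕ) : Set where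
  constructor wrap
  field unwrap : a ≡ b [mod m ]
open _≋_[mod_] public

private
  toSigned : a ≋ b [mod m ] → + m Signed.∣ a ℤ.- b
  toSigned {m = m} a≋b = Signed.∣ᵤ⇒∣ {k = + m} (unwrap a≋b)

  fromSigned : + m Signed.∣ a ℤ.- b → a ≋ b [mod m ]
  fromSigned m∣a-b = wrap (Signed.∣⇒∣ᵤ m∣a-b)

  difference-trans : ∀ a b c → (a ℤ.- b) ℤ.+ (b ℤ.- c) ≡ a ℤ.- c
  difference-trans = solve-∀

  difference-+ : ∀ a b c d → (a ℤ.- b) ℤ.+ (c ℤ.- d) ≡ (a ℤ.+ c) ℤ.- (b ℤ.+ d)
  difference-+ = solve-∀

  difference-*ˡ : ∀ c a b → c ℤ.* (a ℤ.- b) ≡ c ℤ.* a ℤ.- c ℤ.* b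
  difference-*ˡ = solve-∀

  difference-cancelˡ : ∀ c a b → (c ℤ.+ a) ℤ.- (c ℤ.+ b) ≡ a ℤ.- b
  difference-cancelˡ = solve-∀

≋-by-difference : c ℤ.- d ≡ a ℤ.- b → c ≋ d [mod m ] → a ≋ b [mod m ]
≋-by-difference c-d≡a-b c≋d = wrap (subst (_ ∣_) (cong ℤ.∣_∣ c-d≡a-b) (unwrap c≋d))

≋-refl : ∀ {a m} → a ≋ a [mod m ]
≋-refl {a} {m} = wrap (subst (m ∣_) (cong ℤ.∣_∣ (sym (ℤ.+-inverseʳ a))) (m ∣0))

≋-reflexive : a ≡ b → a ≋ b [mod m ]
≋-reflexive refl = ≋-refl

≋-sym : a ≋ b [mod m ] → b ≋ a [mod m ]
≋-sym {a = a} {b = b} a≋b = wrap (subst (_ ∣_) (ℤ.∣i-j∣≡∣j-i∣ a b) (unwrap a≋b))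

≋-trans : a ≋ b [mod m ] → b ≋ c [mod m ] → a ≋ c [mod m ]
≋-trans {a = a} {b = b} {c = c} a≋b b≋c = fromSigned
  (subst (_ Signed.∣_) (difference-trans a b c) (Signed.∣m∣n⇒∣m+n (toSigned a≋b) (toSigned b≋c)))

≋-+-cong : a ≋ b [mod m ] → c ≋ d [mod m ] → a ℤ.+ c ≋ b ℤ.+ d [mod m ]
≋-+-cong {a = a} {b = b} {c = c} {d = d} a≋b c≋d = fromSigned
  (subst (_ Signed.∣_) (difference-+ a b c d) (Signed.∣m∣n⇒∣m+n (toSigned a≋b) (toSigned c≋d)))

≋-+-congˡ : ∀ c → a ≋ b [mod m ] → c ℤ.+ a ≋ c ℤ.+ b [mod m ]
≋-+-congˡ c = ≋-+-cong (≋-refl {c})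

≋-*-congˡ : ∀ c → a ≋ b [mod m ] → c ℤ.* a ≋ c ℤ.* b [mod m ]
≋-*-congˡ {a = a} {b = b} c a≋b = fromSigned
  (subst (_ Signed.∣_) (difference-*ˡ c a b) (Signed.∣n⇒∣m*n c (toSigned a≋b)))

≋-+-cancelˡ : ∀ c → c ℤ.+ a ≋ c ℤ.+ b [mod m ] → a ≋ b [mod m ]
≋-+-cancelˡ {a = a} {b = b} c = ≋-by-difference (difference-cancelˡ c a b)

≋⇒difference≋0 : a ≋ b [mod m ] → a ℤ.- b ≋ 0ℤ [mod m ]
≋⇒difference≋0 {a = a} {b = b} = ≋-by-difference (sym (ℤ.+-identityʳ (a ℤ.- b)))

≋-weaken : m ∣ n → a ≋ b [mod n ] → a ≋ b [mod m ]
≋-weaken m∣n a≋b = wrap (∣-trans m∣n (unwrap a≋b))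

≋-dec : ∀ m a b → Dec (a ≋ b [mod m ])
≋-dec m a b = map′ wrap unwrap (m ∣? ℤ.∣ a ℤ.- b ∣)

≋0⇒∣ : a ≋ 0ℤ [mod m ] → m ∣ ℤ.∣ a ∣
≋0⇒∣ {a = a} a≋0 = subst (_ ∣_) (cong ℤ.∣_∣ (ℤ.+-identityʳ a)) (unwrap a≋0)

∣⇒≋0 : m ∣ ℤ.∣ a ∣ → a ≋ 0ℤ [mod m ]
∣⇒≋0 {a = a} m∣a = wrap (subst (_ ∣_) (cong ℤ.∣_∣ (sym (ℤ.+-identityʳ a))) m∣a)

≋-setoid : ℕ → Setoid _ _
≋-setoid m = record
  { Carrier       = ℤ
  ; _≈_           = _≋_[mod m ]
  ; isEquivalence = record { refl = ≋-refl ; sym = ≋-sym ; trans = ≋-trans }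
  }

module ≋-Reasoning (m : ℕ) = SetoidReasoning (≋-setoid m)

β-diagonal : ∀ i → β i i ≡ 1
β-diagonal i with i ≟ i
... | yes _   = refl
... | no i≢i = ⊥-elim (i≢i refl)

β-offDiagonal : m ≢ n → β m n ≡ 0
β-offDiagonal {m} {n} m≢n with m ≟ n
... | yes m≡n = ⊥-elim (m≢n m≡n)
... | no  _   = refl

β≉0 : ∀ i → ¬ (β i ≗c zeroC)
β≉0 i β≈0 = 1+n≢0 (trans (sym (β-diagonal i)) (β≈0 i))

β∈completion : ∀ {E0} → IsZeckendorf E0 → ∀ i → Completion E0 (β i)
β∈completion E0-zeckendorf i =
  (λ _ → β i) , (λ k → k + suc i) , (λ _ → IsZeckendorf.hasβ E0-zeckendorf i) , (λ _ → ≤-refl) ,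
  (λ k j k+1+i≤j → β-offDiagonal (<⇒≢ (m+n≤o⇒n≤o k k+1+i≤j))) , (λ _ _ _ → refl)

module PAdic (p : ℕ) (p-prime : Prime p) where

  instance
    p≢0 : NonZero p
    p≢0 = prime⇒nonZero p-prime

  p∸1<p : p ∸ 1 < p
  p∸1<p = ∸-monoʳ-< z<s (>-nonZero⁻¹ p)

  2*m≤p∸1⇒m<p : 2 * m ≤ p ∸ 1 → m < p
  2*m≤p∸1⇒m<p {m} 2m≤p∸1 = ≤-<-trans (m≤m+n m _) (≤-<-trans 2m≤p∸1 p∸1<p)

  SmallCoefficients : (Coef → Set) → Set
  SmallCoefficients E = ∀ ε → E ε → ∀ n → ε n < p

  -- ε n ≤ min (√p , (p − 1) / 2), stated without roots or division.
  BoundedCoefficients : (Coef → Set) → Set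
  BoundedCoefficients E = ∀ ε → E ε → ∀ n → (ε n * ε n ≤ p) × (2 * ε n ≤ p ∸ 1)

  bounded⇒small : ∀ {E} → BoundedCoefficients E → SmallCoefficients E
  bounded⇒small bound ε Eε n = 2*m≤p∸1⇒m<p (proj₂ (bound ε Eε n))

  n<p⇒n≢0⇒p∤n : n < p → n ≢ 0 → ¬ p ∣ n
  n<p⇒n≢0⇒p∤n n<p n≢0 p∣n = n≢0 (m∣n∧n<m⇒n≡0 p∣n n<p)

  ∣m-n∣<p⇒p∣m-n⇒m≡n : ∣ m - n ∣ < p → p ∣ ℤ.∣ + m ℤ.- + n ∣ → m ≡ n
  ∣m-n∣<p⇒p∣m-n⇒m≡n {m} {n} ∣m-n∣<p p∣m-n =
    ∣m-n∣≡0⇒m≡n (m∣n∧n<m⇒n≡0 (subst (p ∣_) (∣[+m]-[+n]∣≡∣m-n∣ m n) p∣m-n) ∣m-n∣<p)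

  p^[1+k]∣c*s⇒p∣c : ∀ {k c s} → p ^ k ∣ s → ¬ p ^ suc k ∣ s → p ^ suc k ∣ c * s → p ∣ c
  p^[1+k]∣c*s⇒p∣c {k} {c} (divides q refl) p^1+k∤s p^1+k∣cs
    with euclidsLemma c q p-prime (*-cancelʳ-∣ (p ^ k) {{m^n≢0 p k}}
           (subst (p ^ suc k ∣_) (sym (*-assoc c q (p ^ k))) p^1+k∣cs))
  ... | inj₁ p∣c = p∣c
  ... | inj₂ p∣q = ⊥-elim (p^1+k∤s (*-monoˡ-∣ (p ^ k) p∣q))

  -- A record for the same reason as `_≋_[mod_]`: `x` is then determined by the type.
  infix 4 p^_∣_
  record p^_∣_ (k : ℕ) (x : ℤₚ p) : Set where
    constructor divisible
    field seq≋0 : seq x k ≋ 0ℤ [mod p ^ k ]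
  open p^_∣_ public

  _HasValuation_ : ℤₚ p → ℕ → Set
  x HasValuation k = p^ k ∣ x × ¬ p^ suc k ∣ x

  seq-coherent : (x : ℤₚ p) → m ≤ n → seq x n ≋ seq x m [mod p ^ m ]
  seq-coherent x m≤n = go (≤⇒≤′ m≤n)
    where
    go : m ≤′ n → seq x n ≋ seq x m [mod p ^ m ]
    go ≤′-refl            = ≋-refl
    go (≤′-step {n} m≤′n) =
      ≋-trans (≋-weaken (^-monoʳ-∣ p (≤′⇒≤ m≤′n)) (wrap (coh x n))) (go m≤′n)

  seq≋-weaken : ∀ x y → m ≤ n → seq x n ≋ seq y n [mod p ^ n ] → seq x m ≋ seq y m [mod p ^ m ]
  seq≋-weaken {m} {n} x y m≤n xₙ≋yₙ = begin
    seq x m ≈⟨ seq-coherent x m≤n ⟨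
    seq x n ≈⟨ ≋-weaken (^-monoʳ-∣ p m≤n) xₙ≋yₙ ⟩
    seq y n ≈⟨ seq-coherent y m≤n ⟩
    seq y m ∎
    where open ≋-Reasoning (p ^ m)

  p^∣⇒seq≋0 : ∀ {x} → p^ m ∣ x → m ≤ n → seq x n ≋ 0ℤ [mod p ^ m ]
  p^∣⇒seq≋0 {x = x} p^m∣x m≤n = ≋-trans (seq-coherent x m≤n) (seq≋0 p^m∣x)

  p^∣-weaken : ∀ {x} → m ≤ n → p^ n ∣ x → p^ m ∣ x
  p^∣-weaken {x = x} m≤n p^n∣x =
    divisible (≋-trans (≋-sym (seq-coherent x m≤n)) (≋-weaken (^-monoʳ-∣ p m≤n) (seq≋0 p^n∣x)))

  p^0∣ : ∀ x → p^ 0 ∣ x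
  p^0∣ x = divisible (wrap (1∣ _))

  p^?∣ : ∀ k x → Dec (p^ k ∣ x)
  p^?∣ k x = map′ divisible seq≋0 (≋-dec (p ^ k) (seq x k) 0ℤ)

  valuation-maximal : ∀ {x} → x HasValuation m → p^ n ∣ x → n ≤ m
  valuation-maximal {m} {n} (_ , p^1+m∤x) p^n∣x with n ≤? m
  ... | yes n≤m = n≤m
  ... | no  n≰m = ⊥-elim (p^1+m∤x (p^∣-weaken (≰⇒> n≰m) p^n∣x))

  valuation-unique : ∀ {x} → x HasValuation m → x HasValuation n → m ≡ n
  valuation-unique val-m val-n =
    ≤-antisym (valuation-maximal val-n (proj₁ val-m)) (valuation-maximal val-m (proj₁ val-n))

  valuation-exists : ∀ {x} → ¬ p^ suc n ∣ x → ∃ λ k → x HasValuation k × k ≤ n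
  valuation-exists {n} {x} p^1+n∤x with p^?∣ n x
  ... | yes p^n∣x = n , (p^n∣x , p^1+n∤x) , ≤-refl
  valuation-exists {zero}  {x} _ | no p^0∤x = ⊥-elim (p^0∤x (p^0∣ x))
  valuation-exists {suc n} {x} _ | no p^1+n∤x with valuation-exists p^1+n∤x
  ... | k , val , k≤n = k , val , m≤n⇒m≤1+n k≤n

  p^[1+v]∣c*x⇒p∣c : ∀ {k x} c → x HasValuation k →
                    c ℤ.* seq x (suc k) ≋ 0ℤ [mod p ^ suc k ] → p ∣ ℤ.∣ c ∣
  p^[1+v]∣c*x⇒p∣c {k} {x} c (p^k∣x , p^1+k∤x) cx≋0 = p^[1+k]∣c*s⇒p∣c {k}
    (≋0⇒∣ (p^∣⇒seq≋0 p^k∣x (n≤1+n k)))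
    (λ p^1+k∣s → p^1+k∤x (divisible (∣⇒≋0 p^1+k∣s)))
    (subst (_ ∣_) (ℤ.abs-* c (seq x (suc k))) (≋0⇒∣ cx≋0))

  >ₚ⇒hasValuation : ∀ {x y : ℤₚ p} → x >ₚ y → ∃ (x HasValuation_)
  >ₚ⇒hasValuation (n , x≢0 , _) =
    let k , val , _ = valuation-exists (λ p^1+n∣x → x≢0 (unwrap (seq≋0 p^1+n∣x))) in k , val

  >ₚ⇒valuation-< : ∀ {x y : ℤₚ p} → x >ₚ y → x HasValuation m → y HasValuation n → m < n
  >ₚ⇒valuation-< {m} (k , x≢0 , y≡0) (p^m∣x , _) val-y with m ≤? k
  ... | yes m≤k = ≤-trans (s≤s m≤k) (valuation-maximal val-y (divisible (wrap y≡0)))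
  ... | no  m≰k = ⊥-elim (x≢0 (unwrap (seq≋0 (p^∣-weaken (≰⇒> m≰k) p^m∣x))))

  module _ (Q : ℕ → ℤₚ p) where

    partialSum-cong : ∀ {δ γ} N k → (∀ i → i < N → δ i ≡ γ i) →
                      partialSum δ Q N k ≡ partialSum γ Q N k
    partialSum-cong zero    k _   = refl
    partialSum-cong (suc N) k δ≡γ = cong₂ (λ s d → s ℤ.+ + d ℤ.* seq (Q N) k)
      (partialSum-cong N k (λ i i<N → δ≡γ i (m≤n⇒m≤1+n i<N))) (δ≡γ N ≤-refl)

    partialSum-vanishing : ∀ {δ} N k → (∀ i → i < N → δ i ≡ 0) → partialSum δ Q N k ≡ 0ℤ
    partialSum-vanishing zero    k _   = refl
    partialSum-vanishing (suc N) k δ≡0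
      rewrite partialSum-vanishing N k (λ i i<N → δ≡0 i (m≤n⇒m≤1+n i<N)) | δ≡0 N ≤-refl = refl

    partialSum-β : ∀ {i} N k → i < N → partialSum (β i) Q N k ≡ seq (Q i) k
    partialSum-β {i} (suc N) k i<1+N with i ≟ N
    ... | yes refl = begin
      partialSum (β i) Q i k ℤ.+ + 1 ℤ.* seq (Q i) k
        ≡⟨ cong (ℤ._+ _) (partialSum-vanishing i k (λ j j<i → β-offDiagonal (>⇒≢ j<i))) ⟩
      0ℤ ℤ.+ + 1 ℤ.* seq (Q i) k
        ≡⟨ trans (ℤ.+-identityˡ _) (ℤ.*-identityˡ _) ⟩
      seq (Q i) k ∎
      where open ≡-Reasoning
    ... | no i≢N = trans (ℤ.+-identityʳ _) (partialSum-β N k (≤∧≢⇒< (≤-pred i<1+N) i≢N))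

    sum-β : ∀ i → SumTo (β i) Q (Q i)
    sum-β i k = suc i , λ N i<N → unwrap (≋-reflexive (partialSum-β N k i<N))

    partialSum-stable : ∀ {k J N} δ → J ≤ N → (∀ i → J ≤ i → p^ k ∣ Q i) →
                        partialSum δ Q N k ≋ partialSum δ Q J k [mod p ^ k ]
    partialSum-stable {k} {J} δ J≤N p^k∣Qᵢ = go (≤⇒≤′ J≤N)
      where
      go : ∀ {N} → J ≤′ N → partialSum δ Q N k ≋ partialSum δ Q J k [mod p ^ k ]
      go ≤′-refl            = ≋-refl
      go (≤′-step {N} J≤′N) = begin
        partialSum δ Q N k ℤ.+ + δ N ℤ.* seq (Q N) k
          ≈⟨ ≋-+-cong (go J≤′N) (≋-*-congˡ (+ δ N) (seq≋0 (p^k∣Qᵢ N (≤′⇒≤ J≤′N)))) ⟩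
        partialSum δ Q J k ℤ.+ + δ N ℤ.* 0ℤ
          ≡⟨ trans (cong (ℤ._+_ (partialSum δ Q J k)) (ℤ.*-zeroʳ (+ δ N))) (ℤ.+-identityʳ _) ⟩
        partialSum δ Q J k ∎
        where open ≋-Reasoning (p ^ k)

    sum≋partialSum : ∀ {δ x k} J → SumTo δ Q x → (∀ i → J ≤ i → p^ k ∣ Q i) →
                     seq x k ≋ partialSum δ Q J k [mod p ^ k ]
    sum≋partialSum {δ} {k = k} J Σδ p^k∣Qᵢ with Σδ k
    ... | N , converges = ≋-trans (≋-sym (wrap (converges (N ⊔ J) (m≤m⊔n N J))))
                                  (partialSum-stable δ (m≤n⊔m N J) p^k∣Qᵢ)

  record Graded (Q : ℕ → ℤₚ p) (v : ℕ → ℕ) : Set where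
    field
      valuation  : ∀ k → Q k HasValuation v k
      increasing : ∀ k → v k < v (suc k)

  decreasing⇒graded : ∀ {Q} → Decreasing Q → Σ (ℕ → ℕ) (Graded Q)
  decreasing⇒graded {Q} dec = v , record
    { valuation  = valuation
    ; increasing = λ k → >ₚ⇒valuation-< (dec k) (valuation k) (valuation (suc k))
    }
    where
    hasValuation : ∀ k → ∃ (Q k HasValuation_)
    hasValuation k = >ₚ⇒hasValuation {Q k} {Q (suc k)} (dec k)
    v : ℕ → ℕ
    v k = proj₁ (hasValuation k)
    valuation : ∀ k → Q k HasValuation v k
    valuation k = proj₂ (hasValuation k)

  Graded-cong : ∀ {Q v w} → Graded Q w → (∀ k → w k ≡ v k) → Graded Q v
  Graded-cong {Q} graded w≗v = record
    { valuation  = λ k → subst (Q k HasValuation_) (w≗v k) (valuation k)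
    ; increasing = λ k → subst₂ _<_ (w≗v k) (w≗v (suc k)) (increasing k)
    }
    where open Graded graded

  module GradedSum {Q : ℕ → ℤₚ p} {v : ℕ → ℕ} (graded : Graded Q v) where
    open Graded graded public
    open StrictlyIncreasing v increasing public

    sum≋truncation : ∀ {δ k} x j → k ≤ v j → SumTo δ Q x →
                     seq x k ≋ partialSum δ Q j k [mod p ^ k ]
    sum≋truncation x j k≤vj Σδ = sum≋partialSum Q {x = x} j Σδ
      (λ i j≤i → p^∣-weaken (≤-trans k≤vj (mono-≤ j≤i)) (proj₁ (valuation i)))

    vanishing-below⇒p^∣ : ∀ {δ k} x j → (∀ i → i < j → δ i ≡ 0) → k ≤ v j → SumTo δ Q x → p^ k ∣ x
    vanishing-below⇒p^∣ {k = k} x j δ<j≡0 k≤vj Σδ = divisible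
      (≋-trans (sum≋truncation x j k≤vj Σδ) (≋-reflexive (partialSum-vanishing Q j k δ<j≡0)))

    leadingTerm : ∀ {δ} x j → (∀ i → i < j → δ i ≡ 0) → SumTo δ Q x →
                  seq x (suc (v j)) ≋ + δ j ℤ.* seq (Q j) (suc (v j)) [mod p ^ suc (v j) ]
    leadingTerm x j δ<j≡0 Σδ = ≋-trans (sum≋truncation x (suc j) (increasing j) Σδ) (≋-reflexive
      (trans (cong (λ s → s ℤ.+ _) (partialSum-vanishing Q j _ δ<j≡0)) (ℤ.+-identityˡ _)))

    leadingValuation : ∀ {δ} x j → (∀ i → i < j → δ i ≡ 0) → ¬ p ∣ δ j → SumTo δ Q x →
                       x HasValuation v j
    leadingValuation {δ} x j δ<j≡0 p∤δⱼ Σδ = vanishing-below⇒p^∣ x j δ<j≡0 ≤-refl Σδ ,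
      λ p^1+vj∣x → p∤δⱼ (p^[1+v]∣c*x⇒p∣c (+ δ j) (valuation j)
        (≋-trans (≋-sym (leadingTerm x j δ<j≡0 Σδ)) (seq≋0 p^1+vj∣x)))

    leadingIndex : ∀ {δ L} x → (∀ i → δ i < p) → SumTo δ Q x → ¬ p^ L ∣ x →
                   ∃ λ j → (∀ i → i < j → δ i ≡ 0) × δ j ≢ 0 × x HasValuation v j
    leadingIndex {δ} {L} x δ<p Σδ p^L∤x with leastCounterexample (λ i → δ i ≟ 0) L
    ... | inj₁ δ<L≡0 = ⊥-elim (p^L∤x (vanishing-below⇒p^∣ x L δ<L≡0 (n≤f[n] L) Σδ))
    ... | inj₂ (j , _ , δⱼ≢0 , δ<j≡0) =
      j , δ<j≡0 , δⱼ≢0 , leadingValuation x j δ<j≡0 (n<p⇒n≢0⇒p∤n (δ<p j) δⱼ≢0) Σδ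

  decreasing⇒uniqueRep : (E : Coef → Set) → SmallCoefficients E →
                         (Q : ℕ → ℤₚ p) → Decreasing Q → UniqueRep E Q
  decreasing⇒uniqueRep E small Q dec δ δ′ Eδ Eδ′ δ≉δ′ x y Σδ Σδ′ x≈y = δ≉δ′ (<-rec _ agree)
    where
    v : ℕ → ℕ
    v = proj₁ (decreasing⇒graded {Q} dec)
    open GradedSum (proj₂ (decreasing⇒graded {Q} dec))
    agree : ∀ m → (∀ {i} → i < m → δ i ≡ δ′ i) → δ m ≡ δ′ m
    agree m δ≡δ′-below = ∣m-n∣<p⇒p∣m-n⇒m≡n
      (≤-<-trans (∣m-n∣≤m⊔n (δ m) (δ′ m)) (⊔-pres-<m (small δ Eδ m) (small δ′ Eδ′ m)))
      (p^[1+v]∣c*x⇒p∣c (+ δ m ℤ.- + δ′ m) (valuation m) difference≋0)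
      where
      r = suc (v m)
      s = seq (Q m) r
      P = partialSum δ Q m r
      terms≋ : P ℤ.+ + δ m ℤ.* s ≋ P ℤ.+ + δ′ m ℤ.* s [mod p ^ r ]
      terms≋ = begin
        P ℤ.+ + δ m ℤ.* s                    ≈⟨ sum≋truncation x (suc m) (increasing m) Σδ ⟨
        seq x r                              ≈⟨ wrap (x≈y r) ⟩
        seq y r                              ≈⟨ sum≋truncation y (suc m) (increasing m) Σδ′ ⟩
        partialSum δ′ Q m r ℤ.+ + δ′ m ℤ.* s ≡⟨ cong (λ t → t ℤ.+ + δ′ m ℤ.* s)
                                                   (partialSum-cong Q m r (λ i i<m → sym (δ≡δ′-below i<m))) ⟩
        P ℤ.+ + δ′ m ℤ.* s                   ∎
        where open ≋-Reasoning (p ^ r)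
      *-distribʳ-minus : ∀ d e s → (d ℤ.- e) ℤ.* s ≡ d ℤ.* s ℤ.- e ℤ.* s
      *-distribʳ-minus = solve-∀
      difference≋0 : (+ δ m ℤ.- + δ′ m) ℤ.* s ≋ 0ℤ [mod p ^ r ]
      difference≋0 = ≋-trans (≋-reflexive (*-distribʳ-minus (+ δ m) (+ δ′ m) s))
                             (≋⇒difference≋0 (≋-+-cancelˡ P terms≋))

  fundamental⇒expansion : ∀ {E Y A B} → (∀ i → E (β i)) → Fundamental E Y A → Fundamental E Y B →
                          ∀ k → InX E A (B k)
  fundamental⇒expansion {B = B} Eβ (_ , _ , Y≡XA) (_ , _ , Y≡XB) k =
    proj₁ (Y≡XA (B k)) (proj₂ (Y≡XB (B k)) (β k , Eβ k , β≉0 k , sum-β B k))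

  module _ (E : Coef → Set) (small : SmallCoefficients E) where

    expansion-valuation : ∀ {Q v x} → Graded Q v → InX E Q x → x HasValuation m → ∃ λ j → m ≡ v j
    expansion-valuation graded (δ , Eδ , _ , Σδ) val-x =
      let j , _ , _ , val-x′ = leadingIndex _ (small δ Eδ) Σδ (proj₂ val-x)
      in  j , valuation-unique val-x val-x′
      where open GradedSum graded

    valuations-agree : ∀ {A B v w} → Graded A v → Graded B w →
                       (∀ k → InX E A (B k)) → (∀ k → InX E B (A k)) → ∀ k → w k ≡ v k
    valuations-agree {v = v} {w} gA gB B∈XA A∈XB = increasing-sameRange⇒≗ v w
      (Graded.increasing gA) (Graded.increasing gB)
      (λ k → expansion-valuation gA (B∈XA k) (Graded.valuation gB k))
      (λ k → expansion-valuation gB (A∈XB k) (Graded.valuation gA k))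

    module Expansion {Q R : ℕ → ℤₚ p} {v : ℕ → ℕ} (gQ : Graded Q v) (gR : Graded R v)
                     (R∈XQ : ∀ k → InX E Q (R k)) where
      open GradedSum gQ

      coeff : ℕ → Coef
      coeff k = proj₁ (R∈XQ k)

      coeff∈E : ∀ k → E (coeff k)
      coeff∈E k = proj₁ (proj₂ (R∈XQ k))

      coeff-small : ∀ k i → coeff k i < p
      coeff-small k = small (coeff k) (coeff∈E k)

      coeff-sum : ∀ k → SumTo (coeff k) Q (R k)
      coeff-sum k = proj₂ (proj₂ (proj₂ (R∈XQ k)))

      coeff-leading : ∀ k → (∀ i → i < k → coeff k i ≡ 0) × coeff k k ≢ 0
      coeff-leading k
        with leadingIndex (R k) (coeff-small k) (coeff-sum k) (proj₂ (Graded.valuation gR k))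
      ... | j , coeff<j≡0 , coeffⱼ≢0 , val with injective (valuation-unique val (Graded.valuation gR k))
      ... | refl = coeff<j≡0 , coeffⱼ≢0

      R≋leadingTerm : ∀ k → seq (R k) (suc (v k)) ≋ + coeff k k ℤ.* seq (Q k) (suc (v k))
                              [mod p ^ suc (v k) ]
      R≋leadingTerm k = leadingTerm (R k) k (proj₁ (coeff-leading k)) (coeff-sum k)

      partialSum≡Qₙ : ∀ {n j k} → n < j → (∀ i → i < j → coeff n i ≡ β n i) →
                      partialSum (coeff n) Q j k ≡ seq (Q n) k
      partialSum≡Qₙ {n} {j} {k} n<j coeff≡β =
        trans (partialSum-cong Q j k coeff≡β) (partialSum-β Q j k n<j)

      -- m is the first index at which the expansion of R n in Q differs from β n.
      record Deviation (n m : ℕ) : Set where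
        field
          coeff≢0 : coeff n m ≢ 0
          at      : seq (R n) (suc (v m)) ≋ seq (Q n) (suc (v m)) ℤ.+ + coeff n m ℤ.* seq (Q m) (suc (v m))
                      [mod p ^ suc (v m) ]
          before  : seq (R n) (v m) ≋ seq (Q n) (v m) [mod p ^ v m ]

      deviation : ∀ {n L} → coeff n n ≡ 1 → ¬ seq (R n) L ≋ seq (Q n) L [mod p ^ L ] → ∃ (Deviation n)
      -- Searching past n makes every term of β n visible in the truncated sums.
      deviation {n} {L} coeffₙₙ≡1 Rₙ≉Qₙ with leastCounterexample (λ i → coeff n i ≟ β n i) (L ⊔ suc n)
      ... | inj₁ coeff≡β = ⊥-elim (Rₙ≉Qₙ (seq≋-weaken (R n) (Q n) (m≤m⊔n L (suc n)) (begin
        seq (R n) J                ≈⟨ sum≋truncation (R n) J (n≤f[n] J) (coeff-sum n) ⟩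
        partialSum (coeff n) Q J J ≡⟨ partialSum≡Qₙ (m≤n⊔m L (suc n)) coeff≡β ⟩
        seq (Q n) J                ∎)))
        where
        J = L ⊔ suc n
        open ≋-Reasoning (p ^ J)
      ... | inj₂ (m , _ , coeff≢β , coeff≡β) = m , record
        { coeff≢0 = λ coeffₙₘ≡0 → coeff≢β (trans coeffₙₘ≡0 (sym (β-offDiagonal (<⇒≢ n<m))))
        ; at      = ≋-trans (sum≋truncation (R n) (suc m) (increasing m) (coeff-sum n)) (≋-reflexive
                      (cong (λ s → s ℤ.+ + coeff n m ℤ.* seq (Q m) (suc (v m))) (partialSum≡Qₙ n<m coeff≡β)))
        ; before  = ≋-trans (sum≋truncation (R n) m ≤-refl (coeff-sum n))
                            (≋-reflexive (partialSum≡Qₙ n<m coeff≡β))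
        }
        where
        n<m : n < m
        n<m with <-cmp n m
        ... | tri< n<m _ _ = n<m
        ... | tri≈ _ refl _ = ⊥-elim (coeff≢β (trans coeffₙₙ≡1 (sym (β-diagonal n))))
        ... | tri> _ _ m<n =
          ⊥-elim (coeff≢β (trans (proj₁ (coeff-leading n) m m<n) (sym (β-offDiagonal (>⇒≢ m<n)))))

      deviation-separates : ∀ {n m} → Deviation n m →
                            ¬ seq (Q n) (suc (v m)) ≋ seq (R n) (suc (v m)) [mod p ^ suc (v m) ]
      deviation-separates {n} {m} dev Qₙ≋Rₙ = n<p⇒n≢0⇒p∤n (coeff-small n m) coeff≢0
        (p^[1+v]∣c*x⇒p∣c (+ coeff n m) (valuation m) (≋-sym (≋-+-cancelˡ Qₙ (begin
          Qₙ ℤ.+ 0ℤ                          ≡⟨ ℤ.+-identityʳ Qₙ ⟩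
          Qₙ                                 ≈⟨ Qₙ≋Rₙ ⟩
          seq (R n) r                        ≈⟨ at ⟩
          Qₙ ℤ.+ + coeff n m ℤ.* seq (Q m) r ∎))))
        where
        open Deviation dev
        r = suc (v m)
        Qₙ = seq (Q n) r
        open ≋-Reasoning (p ^ r)

  module MutualExpansions (E : Coef → Set) (bound : BoundedCoefficients E)
                          {A B : ℕ → ℤₚ p} {v : ℕ → ℕ} (gA : Graded A v) (gB : Graded B v)
                          (B∈XA : ∀ k → InX E A (B k)) (A∈XB : ∀ k → InX E B (A k)) where
    open GradedSum gA using (valuation; mono-<)

    module AB = Expansion E (bounded⇒small bound) gA gB B∈XA
    module BA = Expansion E (bounded⇒small bound) gB gA A∈XB

    diagonal-product≡1 : ∀ k → BA.coeff k k * AB.coeff k k ≡ 1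
    diagonal-product≡1 k = sym (∣m-n∣<p⇒p∣m-n⇒m≡n ∣1-γδ∣<p
      (subst (λ t → p ∣ ℤ.∣ + 1 ℤ.- t ∣) (sym (ℤ.pos-* γ δ)) p∣1-γδ))
      where
      γ = BA.coeff k k
      δ = AB.coeff k k
      r = suc (v k)
      Aₖ = seq (A k) r
      factor : ∀ a c d → a ℤ.- c ℤ.* (d ℤ.* a) ≡ (ℤ.1ℤ ℤ.- c ℤ.* d) ℤ.* a
      factor = solve-∀
      Aₖ≋γδAₖ : Aₖ ≋ + γ ℤ.* (+ δ ℤ.* Aₖ) [mod p ^ r ]
      Aₖ≋γδAₖ = ≋-trans (BA.R≋leadingTerm k) (≋-*-congˡ (+ γ) (AB.R≋leadingTerm k))
      p∣1-γδ : p ∣ ℤ.∣ + 1 ℤ.- + γ ℤ.* + δ ∣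
      p∣1-γδ = p^[1+v]∣c*x⇒p∣c (+ 1 ℤ.- + γ ℤ.* + δ) (valuation k)
        (≋-trans (≋-reflexive (sym (factor Aₖ (+ γ) (+ δ)))) (≋⇒difference≋0 Aₖ≋γδAₖ))
      1≤γδ : 1 ≤ γ * δ
      1≤γδ = *-mono-≤ (n≢0⇒n>0 (proj₂ (BA.coeff-leading k))) (n≢0⇒n>0 (proj₂ (AB.coeff-leading k)))
      γδ≤p : γ * δ ≤ p
      γδ≤p = m*m≤o⇒n*n≤o⇒m*n≤o γ δ (proj₁ (bound _ (BA.coeff∈E k) k)) (proj₁ (bound _ (AB.coeff∈E k) k))
      ∣1-γδ∣<p : ∣ 1 - γ * δ ∣ < p
      ∣1-γδ∣<p = subst (_< p) (sym (m≤n⇒∣m-n∣≡n∸m 1≤γδ)) (<-≤-trans (∸-monoʳ-< z<s 1≤γδ) γδ≤p)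

    AB-diagonal≡1 : ∀ k → AB.coeff k k ≡ 1
    AB-diagonal≡1 k = m*n≡1⇒n≡1 (BA.coeff k k) (AB.coeff k k) (diagonal-product≡1 k)

    BA-diagonal≡1 : ∀ k → BA.coeff k k ≡ 1
    BA-diagonal≡1 k = m*n≡1⇒m≡1 (BA.coeff k k) (AB.coeff k k) (diagonal-product≡1 k)

    B≋A-leading : ∀ k → seq (B k) (suc (v k)) ≋ seq (A k) (suc (v k)) [mod p ^ suc (v k) ]
    B≋A-leading k = ≋-trans (AB.R≋leadingTerm k) (≋-reflexive (begin
      + AB.coeff k k ℤ.* Aₖ ≡⟨ cong (λ c → + c ℤ.* Aₖ) (AB-diagonal≡1 k) ⟩
      + 1 ℤ.* Aₖ            ≡⟨ ℤ.*-identityˡ Aₖ ⟩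
      Aₖ                    ∎))
      where
      Aₖ = seq (A k) (suc (v k))
      open ≡-Reasoning

    coincident-deviations : ∀ {n m} → AB.Deviation n m → BA.Deviation n m → ⊥
    coincident-deviations {n} {m} dev dev′ = n<p⇒n≢0⇒p∤n e+e′<p e+e′≢0
      (p^[1+v]∣c*x⇒p∣c (+ e ℤ.+ + e′) (valuation m) (≋-sym (≋-+-cancelˡ (Bₙ ℤ.+ Aₙ) (begin
        (Bₙ ℤ.+ Aₙ) ℤ.+ 0ℤ
          ≡⟨ ℤ.+-identityʳ _ ⟩
        Bₙ ℤ.+ Aₙ
          ≈⟨ ≋-+-cong (AB.Deviation.at dev) (BA.Deviation.at dev′) ⟩
        (Aₙ ℤ.+ + e ℤ.* Aₘ) ℤ.+ (Bₙ ℤ.+ + e′ ℤ.* seq (B m) r)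
          ≈⟨ ≋-+-congˡ (Aₙ ℤ.+ + e ℤ.* Aₘ) (≋-+-congˡ Bₙ (≋-*-congˡ (+ e′) (B≋A-leading m))) ⟩
        (Aₙ ℤ.+ + e ℤ.* Aₘ) ℤ.+ (Bₙ ℤ.+ + e′ ℤ.* Aₘ)
          ≡⟨ regroup Aₙ Bₙ Aₘ (+ e) (+ e′) ⟩
        (Bₙ ℤ.+ Aₙ) ℤ.+ (+ e ℤ.+ + e′) ℤ.* Aₘ ∎))))
      where
      e = AB.coeff n m
      e′ = BA.coeff n m
      r = suc (v m)
      Aₙ = seq (A n) r
      Bₙ = seq (B n) r
      Aₘ = seq (A m) r
      regroup : ∀ x y s u w → (x ℤ.+ u ℤ.* s) ℤ.+ (y ℤ.+ w ℤ.* s) ≡ (y ℤ.+ x) ℤ.+ (u ℤ.+ w) ℤ.* s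
      regroup = solve-∀
      e+e′<p : e + e′ < p
      e+e′<p = ≤-<-trans
        (2*m≤o⇒2*n≤o⇒m+n≤o e e′ (proj₂ (bound _ (AB.coeff∈E n) m)) (proj₂ (bound _ (BA.coeff∈E n) m)))
        p∸1<p
      e+e′≢0 : e + e′ ≢ 0
      e+e′≢0 e+e′≡0 = AB.Deviation.coeff≢0 dev (m+n≡0⇒m≡0 e e+e′≡0)
      open ≋-Reasoning (p ^ r)

    deviations-impossible : ∀ {n m m′} → AB.Deviation n m → BA.Deviation n m′ → ⊥
    deviations-impossible {n} {m} {m′} dev dev′ with <-cmp m m′
    ... | tri< m<m′ _ _ =
      AB.deviation-separates dev (seq≋-weaken (A n) (B n) (mono-< m<m′) (BA.Deviation.before dev′))
    ... | tri≈ _ refl _ = coincident-deviations dev dev′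
    ... | tri> _ _ m′<m =
      BA.deviation-separates dev′ (seq≋-weaken (B n) (A n) (mono-< m′<m) (AB.Deviation.before dev))

    B≈A : ∀ n → B n ≈ₚ A n
    B≈A n L = unwrap (decidable-stable (≋-dec (p ^ L) (seq (B n) L) (seq (A n) L)) λ Bₙ≉Aₙ →
      deviations-impossible (proj₂ (AB.deviation (AB-diagonal≡1 n) Bₙ≉Aₙ))
                            (proj₂ (BA.deviation (BA-diagonal≡1 n) (λ Aₙ≋Bₙ → Bₙ≉Aₙ (≋-sym Aₙ≋Bₙ)))))

  mutualExpansions⇒≈ : (E : Coef → Set) → BoundedCoefficients E →
                       {A B : ℕ → ℤₚ p} → Decreasing A → Decreasing B →
                       (∀ k → InX E A (B k)) → (∀ k → InX E B (A k)) → ∀ k → B k ≈ₚ A k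
  mutualExpansions⇒≈ E bound decA decB B∈XA A∈XB =
    MutualExpansions.B≈A E bound gA (Graded-cong gB (valuations-agree E (bounded⇒small bound) gA gB B∈XA A∈XB))
      B∈XA A∈XB
    where
    gA = proj₂ (decreasing⇒graded decA)
    gB = proj₂ (decreasing⇒graded decB)

theorem2p25 : (p : ℕ) → Prime p →
  ((E : Coef → Set) → E zeroC → (∀ i → E (β i)) →
    (∀ ε → E ε → ∀ n → ε n < p) →
    (Q : ℕ → ℤₚ p) → Decreasing Q → UniqueRep E Q)
  ×
  ((E0 : Coef → Set) → IsZeckendorf E0 →
    (∀ ε → Completion E0 ε → ∀ n → (ε n * ε n ≤ p) × (2 * ε n ≤ p ∸ 1)) →
    (Y : ℤₚ p → Set) → DecreasingESubset (Completion E0) Y →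
    Σ (ℕ → ℤₚ p) (λ Q → Fundamental (Completion E0) Y Q
      × ((Q' : ℕ → ℤₚ p) → Fundamental (Completion E0) Y Q' → ∀ k → Q' k ≈ₚ Q k)))
theorem2p25 p p-prime =
  (λ E _ _ small → decreasing⇒uniqueRep E small) ,
  λ E0 E0-zeckendorf bound Y (Q , Q-fundamental) → Q , Q-fundamental , λ Q′ Q′-fundamental →
    mutualExpansions⇒≈ (Completion E0) bound (proj₁ Q-fundamental) (proj₁ Q′-fundamental)
      (fundamental⇒expansion (β∈completion E0-zeckendorf) Q-fundamental Q′-fundamental)
      (fundamental⇒expansion (β∈completion E0-zeckendorf) Q′-fundamental Q-fundamental)
  where open PAdic p p-prime
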